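{- For every integer $n\geq 2$, $$L_{n+1}(q)=3L_n(q)+2(q-1)L_{n-1}(q).$$
   Context: Define polynomials $b_n(q)$, $n\geq 1$, by $b_1(q)=1$ and, for $n\geq 1$ (and for the second and third relations also $n\geq 0$ whenever the indices involved are $\geq 1$), $b_{2n}(q)=b_n(q)$, $b_{4n+1}(q)=q\,b_{2n}(q)+b_{2n+1}(q)$, $b_{4n+3}(q)=b_{2n+1}(q)+q\,b_{2n+2}(q)$. For $n\geq 1$ let $L_n(q)=2\left(\sum_{k=1}^{2^n-1}b_k(q)\right)+b_{2^n}(q)$. -}

module Defs where

open import Data.Nat as ℕ using (ℕ; zero; suc; _^_)
open import Data.Nat.DivMod using (_/_; _%_)
open import Data.Integer as ℤ using (ℤ; +_)
open import Relation.Binary.PropositionalEquality using (_≡_)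

-- Polynomials in ℤ[q], represented by their coefficient sequences:
-- (p i) is the coefficient of q^i.
Poly : Set
Poly = ℕ → ℤ

_≈P_ : Poly → Poly → Set
p ≈P r = ∀ i → p i ≡ r i

infix 4 _≈P_
infixl 6 _+P_ _-P_
infixr 7 _·P_

0P 1P : Poly
0P _ = + 0
1P zero = + 1
1P (suc _) = + 0

_+P_ : Poly → Poly → Poly
(p +P r) i = p i ℤ.+ r i

_-P_ : Poly → Poly → Poly
(p -P r) i = p i ℤ.- r i

_·P_ : ℤ → Poly → Poly
(c ·P p) i = c ℤ.* p i

-- multiplication by the indeterminate q
qP : Poly → Poly
qP p zero = + 0
qP p (suc i) = p i

-- b with explicit fuel; the recursion on n terminates since all
-- recursive indices are < n, so fuel n suffices.
bF : ℕ → ℕ → Poly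
bF zero _ = 0P
bF (suc f) n = step (n % 4) (n / 4)
  where
    -- n = 4m + r
    step : ℕ → ℕ → Poly
    step 1 zero = 1P
    step 1 m@(suc _) = qP (bF f (2 ℕ.* m)) +P bF f (2 ℕ.* m ℕ.+ 1)
    step 3 m = bF f (2 ℕ.* m ℕ.+ 1) +P qP (bF f (2 ℕ.* m ℕ.+ 2))
    step _ _ = bF f (n / 2)

-- b_n(q) for n ≥ 1 (b 0 is an irrelevant junk value)
b : ℕ → Poly
b n = bF n n

sumB : ℕ → Poly
sumB zero = 0P
sumB (suc m) = sumB m +P b (suc m)

L : ℕ → Poly
L n = (+ 2 ·P sumB (2 ^ n ℕ.∸ 1)) +P b (2 ^ n)

module Submission where

-- Write P M = Σ_{k<M} b_k (with b_0 = 0) and O M = Σ_{k<M} b_{2k+1} for the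
-- partial sums over all indices and over odd indices.  Since b_{2^n} = 1 and
-- Σ_{k=1}^{2^n-1} b_k = P (2^n), we have L_n = 2 P(2^n) + 1.  Splitting a sum
-- over k < 2M by the parity of k, and the odd part by k mod 4, the defining
-- recurrences of b give
--     P (2M) = P M + O M,
--     O (2M) = (q P M + O M) + (O M + q P M + q b_M),
-- and eliminating O yields  P (4M) = 3 P(2M) + 2 (q - 1) P M + q b_M.
-- With M = 2^m this is the claimed recurrence for L (for every n ≥ 1).

open import Defs
open import Data.Nat using (ℕ; zero; suc; _+_; _*_; _∸_; _^_; _≤_; _<_; _≥_; z≤n; s≤s)
open import Data.Nat.Properties
  using (≤-refl; ≤-trans; ≤-pred; +-comm; *-comm; *-assoc; +-mono-≤; *-monoʳ-≤; m≤m*n;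
         m+[n∸m]≡n; m^n>0)
open import Data.Nat.DivMod
  using (_/_; _%_; m%n<n; m%n*o≡m*o%[n*o]; [m+kn]%n≡m%n; +-distrib-/-∣ʳ; m<n⇒m/n≡0; m*n/n≡m)
open import Data.Nat.Divisibility using (divides-refl)
open import Data.Integer as ℤ using (+_)
import Data.Integer.Properties as ℤP
import Data.Integer.Tactic.RingSolver as ℤ-Ring
open import Algebra.Properties.CommutativeSemigroup ℤP.+-commutativeSemigroup
  using (interchange; xy∙z≈xz∙y)
open import Data.Sum using (_⊎_; inj₁; inj₂)
open import Level using (0ℓ)
open import Relation.Binary.Bundles using (Setoid)
import Relation.Binary.Reasoning.Setoid as SetoidReasoning
open import Relation.Binary.PropositionalEquality using (_≡_; refl; sym; trans; cong; cong₂)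

≈P-setoid : Setoid 0ℓ 0ℓ
≈P-setoid = record
  { Carrier       = Poly
  ; _≈_           = _≈P_
  ; isEquivalence = record
    { refl  = λ _ → refl
    ; sym   = λ e i → sym (e i)
    ; trans = λ e e′ i → trans (e i) (e′ i)
    }
  }

module ≈P-Reasoning = SetoidReasoning ≈P-setoid

≡⇒≈P : ∀ {p r} → p ≡ r → p ≈P r
≡⇒≈P refl _ = refl

+P-cong : ∀ {p p′ r r′} → p ≈P p′ → r ≈P r′ → p +P r ≈P p′ +P r′
+P-cong e e′ i = cong₂ ℤ._+_ (e i) (e′ i)

+P-congˡ : ∀ {p p′} r → p ≈P p′ → p +P r ≈P p′ +P r
+P-congˡ r e i = cong (ℤ._+ r i) (e i)

+P-congʳ : ∀ p {r r′} → r ≈P r′ → p +P r ≈P p +P r′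
+P-congʳ p e i = cong (λ x → p i ℤ.+ x) (e i)

-P-cong : ∀ {p p′ r r′} → p ≈P p′ → r ≈P r′ → p -P r ≈P p′ -P r′
-P-cong e e′ i = cong₂ ℤ._-_ (e i) (e′ i)

·P-cong : ∀ c {p p′} → p ≈P p′ → c ·P p ≈P c ·P p′
·P-cong c e i = cong (c ℤ.*_) (e i)

qP-cong : ∀ {p r} → p ≈P r → qP p ≈P qP r
qP-cong e zero    = refl
qP-cong e (suc i) = e i

qP-+ : ∀ p r → qP (p +P r) ≈P qP p +P qP r
qP-+ p r zero    = refl
qP-+ p r (suc i) = refl

qP-· : ∀ c p → qP (c ·P p) ≈P c ·P qP p
qP-· c p zero    = sym (ℤP.*-zeroʳ c)
qP-· c p (suc i) = refl

-- Every n is even, 1, 4m+5 or 4m+3: the cases of the definition of b.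
data Shape : ℕ → Set where
  double : ∀ k → Shape (k * 2)
  one    : Shape 1
  4m+5   : ∀ m → Shape (5 + m * 4)
  4m+3   : ∀ m → Shape (3 + m * 4)

shape : ∀ n → Shape n
shape zero = double 0
shape (suc zero) = one
shape (suc (suc n)) with shape n
... | double k = double (suc k)
... | one      = 4m+3 0
... | 4m+5 m   = 4m+3 (suc m)
... | 4m+3 m   = 4m+5 m

even-residue : ∀ k → (k * 2) % 4 ≡ 0 ⊎ (k * 2) % 4 ≡ 2
even-residue k rewrite sym (m%n*o≡m*o%[n*o] k 2 2) with k % 2 | m%n<n k 2
... | 0 | _ = inj₁ refl
... | 1 | _ = inj₂ refl
... | suc (suc _) | s≤s (s≤s ())

remainder-by-4 : ∀ r m → (r + m * 4) % 4 ≡ r % 4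
remainder-by-4 r m = [m+kn]%n≡m%n r m 4

quotient-by-4 : ∀ r m → r < 4 → (r + m * 4) / 4 ≡ m
quotient-by-4 r m r<4 =
  trans (+-distrib-/-∣ʳ r (divides-refl m)) (cong₂ _+_ (m<n⇒m/n≡0 r<4) (m*n/n≡m m 4))

unfold-even : ∀ f n → n % 4 ≡ 0 ⊎ n % 4 ≡ 2 → bF (suc f) n ≡ bF f (n / 2)
unfold-even f n (inj₁ r) rewrite r = refl
unfold-even f n (inj₂ r) rewrite r = refl

unfold-double : ∀ f k → bF (suc f) (k * 2) ≡ bF f k
unfold-double f k = trans (unfold-even f (k * 2) (even-residue k)) (cong (bF f) (m*n/n≡m k 2))

double-plus : ∀ m c → 2 * m + c ≡ c + m * 2
double-plus m c = trans (+-comm (2 * m) c) (cong (λ x → c + x) (*-comm 2 m))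

unfold-4m+5 : ∀ f m → bF (suc f) (5 + m * 4) ≡ qP (bF f (2 + m * 2)) +P bF f (3 + m * 2)
unfold-4m+5 f m
  rewrite remainder-by-4 1 (suc m) | quotient-by-4 1 (suc m) (s≤s (s≤s z≤n))
  = cong₂ (λ x y → qP (bF f x) +P bF f y) (*-comm 2 (suc m)) (double-plus (suc m) 1)

unfold-4m+3 : ∀ f m → bF (suc f) (3 + m * 4) ≡ bF f (1 + m * 2) +P qP (bF f (2 + m * 2))
unfold-4m+3 f m
  rewrite remainder-by-4 3 m | quotient-by-4 3 m (s≤s (s≤s (s≤s (s≤s z≤n))))
  = cong₂ (λ x y → bF f x +P qP (bF f y)) (double-plus m 1) (double-plus m 2)

bF-zero : ∀ f → bF f 0 ≡ 0P
bF-zero zero    = refl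
bF-zero (suc f) = bF-zero f

-- Recursive calls are made at smaller indices, hence within the fuel.
half-bound : ∀ {k f} → k * 2 ≤ suc f → k ≤ f
half-bound {zero}  _ = z≤n
half-bound {suc k} (s≤s (s≤s 2k≤f)) = s≤s (≤-trans (m≤m*n k 2) 2k≤f)

quarter-bound : ∀ {c d h} m → c ≤ d → d + m * 4 ≤ h → c + m * 2 ≤ h
quarter-bound m c≤d bound = ≤-trans (+-mono-≤ c≤d (*-monoʳ-≤ m (s≤s (s≤s z≤n)))) bound

fuel-indep : ∀ {f g n} → n ≤ f → n ≤ g → bF f n ≡ bF g n
fuel-indep {zero}  {g}    z≤n _   = sym (bF-zero g)
fuel-indep {suc f} {zero} _   z≤n = bF-zero (suc f)
fuel-indep {suc f} {suc g} {n} n≤f n≤g with shape n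
... | double k = trans (unfold-double f k)
                   (trans (fuel-indep (half-bound n≤f) (half-bound n≤g)) (sym (unfold-double g k)))
... | one      = refl
... | 4m+5 m   = trans (unfold-4m+5 f m)
                   (trans (cong₂ (λ x y → qP x +P y) (recurse 2≤4) (recurse 3≤4))
                          (sym (unfold-4m+5 g m)))
  where
    2≤4 = s≤s (s≤s z≤n)
    3≤4 = s≤s (s≤s (s≤s z≤n))
    recurse : ∀ {c} → c ≤ 4 → bF f (c + m * 2) ≡ bF g (c + m * 2)
    recurse c≤4 = fuel-indep (quarter-bound m c≤4 (≤-pred n≤f))
                             (quarter-bound m c≤4 (≤-pred n≤g))
... | 4m+3 m   = trans (unfold-4m+3 f m)
                   (trans (cong₂ (λ x y → x +P qP y) (recurse 1≤2) (recurse ≤-refl))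
                          (sym (unfold-4m+3 g m)))
  where
    1≤2 = s≤s z≤n
    recurse : ∀ {c} → c ≤ 2 → bF f (c + m * 2) ≡ bF g (c + m * 2)
    recurse c≤2 = fuel-indep (quarter-bound m c≤2 (≤-pred n≤f))
                             (quarter-bound m c≤2 (≤-pred n≤g))

b-fuel : ∀ {f n} → n ≤ f → bF f n ≡ b n
b-fuel n≤f = fuel-indep n≤f ≤-refl

b-double : ∀ k → b (k * 2) ≡ b k
b-double zero    = refl
b-double (suc k) = trans (unfold-double (1 + k * 2) (suc k)) (b-fuel (s≤s (m≤m*n k 2)))

-- b_{4k+1} = q b_k + b_{2k+1}   (for k = 0 because b_0 = 0)
b-4k+1 : ∀ k → b (1 + k * 4) ≈P qP (b k) +P b (1 + k * 2)
b-4k+1 zero zero    = refl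
b-4k+1 zero (suc i) = refl
b-4k+1 (suc m) = ≡⇒≈P (trans (unfold-4m+5 (4 + m * 4) m)
  (cong₂ (λ x y → qP x +P y) (trans (in-fuel (s≤s (s≤s z≤n))) (b-double (suc m)))
                             (in-fuel (s≤s (s≤s (s≤s z≤n))))))
  where
    in-fuel : ∀ {c} → c ≤ 4 → bF (4 + m * 4) (c + m * 2) ≡ b (c + m * 2)
    in-fuel c≤4 = b-fuel (quarter-bound m c≤4 ≤-refl)

b-4k+3 : ∀ k → b (3 + k * 4) ≡ b (1 + k * 2) +P qP (b (suc k))
b-4k+3 k = trans (unfold-4m+3 (2 + k * 4) k)
  (cong₂ (λ x y → x +P qP y) (in-fuel (s≤s z≤n)) (trans (in-fuel ≤-refl) (b-double (suc k))))
  where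
    in-fuel : ∀ {c} → c ≤ 2 → bF (2 + k * 4) (c + k * 2) ≡ b (c + k * 2)
    in-fuel c≤2 = b-fuel (quarter-bound k c≤2 ≤-refl)

sumBelow : (ℕ → Poly) → ℕ → Poly
sumBelow f zero    = 0P
sumBelow f (suc M) = sumBelow f M +P f M

sum-cong : ∀ {f g} → (∀ k → f k ≈P g k) → ∀ M → sumBelow f M ≈P sumBelow g M
sum-cong e zero    i = refl
sum-cong e (suc M) i = cong₂ ℤ._+_ (sum-cong e M i) (e M i)

sum-+ : ∀ f g M → sumBelow (λ k → f k +P g k) M ≈P sumBelow f M +P sumBelow g M
sum-+ f g zero    i = refl
sum-+ f g (suc M) i =
  trans (cong (ℤ._+ (f M i ℤ.+ g M i)) (sum-+ f g M i))
        (interchange (sumBelow f M i) (sumBelow g M i) (f M i) (g M i))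

sum-q : ∀ f M → sumBelow (λ k → qP (f k)) M ≈P qP (sumBelow f M)
sum-q f zero zero    = refl
sum-q f zero (suc i) = refl
sum-q f (suc M) i =
  trans (cong (ℤ._+ qP (f M) i) (sum-q f M i)) (sym (qP-+ (sumBelow f M) (f M) i))

sum-parity : ∀ f M →
  sumBelow f (M * 2) ≈P sumBelow (λ k → f (k * 2)) M +P sumBelow (λ k → f (1 + k * 2)) M
sum-parity f zero    i = refl
sum-parity f (suc M) i =
  trans (cong (λ x → (x ℤ.+ f (M * 2) i) ℤ.+ f (1 + M * 2) i) (sum-parity f M i))
        (trans (cong (ℤ._+ f (1 + M * 2) i) (xy∙z≈xz∙y evens odds (f (M * 2) i)))
               (ℤP.+-assoc (evens ℤ.+ f (M * 2) i) odds (f (1 + M * 2) i)))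
  where
    evens = sumBelow (λ k → f (k * 2)) M i
    odds  = sumBelow (λ k → f (1 + k * 2)) M i

sum-shift : ∀ f M → sumBelow (λ k → f (suc k)) M +P f 0 ≈P sumBelow f M +P f M
sum-shift f zero    i = refl
sum-shift f (suc M) i =
  trans (xy∙z≈xz∙y (sumBelow (λ k → f (suc k)) M i) (f (suc M) i) (f 0 i))
        (cong (ℤ._+ f (suc M) i) (sum-shift f M i))

P O : ℕ → Poly
P M = sumBelow b M
O M = sumBelow (λ k → b (1 + k * 2)) M

-- Σ_{k<M} b_{k+1} = P M + b_M, because b_0 = 0.
sum-b-suc : ∀ M → sumBelow (λ k → b (suc k)) M ≈P P M +P b M
sum-b-suc M i = trans (sym (ℤP.+-identityʳ _)) (sum-shift b M i)

P-double : ∀ M → P (M * 2) ≈P P M +P O M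
P-double M = begin
  P (M * 2)
    ≈⟨ sum-parity b M ⟩
  sumBelow (λ k → b (k * 2)) M +P O M
    ≈⟨ +P-congˡ (O M) (sum-cong (λ k → ≡⇒≈P (b-double k)) M) ⟩
  P M +P O M
    ∎
  where open ≈P-Reasoning

sum-b-4k+1 : ∀ M → sumBelow (λ k → b (1 + k * 4)) M ≈P qP (P M) +P O M
sum-b-4k+1 M = begin
  sumBelow (λ k → b (1 + k * 4)) M
    ≈⟨ sum-cong b-4k+1 M ⟩
  sumBelow (λ k → qP (b k) +P b (1 + k * 2)) M
    ≈⟨ sum-+ (λ k → qP (b k)) (λ k → b (1 + k * 2)) M ⟩
  sumBelow (λ k → qP (b k)) M +P O M
    ≈⟨ +P-congˡ (O M) (sum-q b M) ⟩
  qP (P M) +P O M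
    ∎
  where open ≈P-Reasoning

sum-b-4k+3 : ∀ M → sumBelow (λ k → b (3 + k * 4)) M ≈P O M +P (qP (P M) +P qP (b M))
sum-b-4k+3 M = begin
  sumBelow (λ k → b (3 + k * 4)) M
    ≈⟨ sum-cong (λ k → ≡⇒≈P (b-4k+3 k)) M ⟩
  sumBelow (λ k → b (1 + k * 2) +P qP (b (suc k))) M
    ≈⟨ sum-+ (λ k → b (1 + k * 2)) (λ k → qP (b (suc k))) M ⟩
  O M +P sumBelow (λ k → qP (b (suc k))) M
    ≈⟨ +P-congʳ (O M) (sum-q (λ k → b (suc k)) M) ⟩
  O M +P qP (sumBelow (λ k → b (suc k)) M)
    ≈⟨ +P-congʳ (O M) (qP-cong (sum-b-suc M)) ⟩
  O M +P qP (P M +P b M)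
    ≈⟨ +P-congʳ (O M) (qP-+ (P M) (b M)) ⟩
  O M +P (qP (P M) +P qP (b M))
    ∎
  where open ≈P-Reasoning

O-double : ∀ M → O (M * 2) ≈P (qP (P M) +P O M) +P (O M +P (qP (P M) +P qP (b M)))
O-double M = begin
  O (M * 2)
    ≈⟨ sum-parity (λ k → b (1 + k * 2)) M ⟩
  sumBelow (λ k → b (1 + k * 2 * 2)) M +P sumBelow (λ k → b (3 + k * 2 * 2)) M
    ≈⟨ +P-cong (regroup-index 1) (regroup-index 3) ⟩
  sumBelow (λ k → b (1 + k * 4)) M +P sumBelow (λ k → b (3 + k * 4)) M
    ≈⟨ +P-cong (sum-b-4k+1 M) (sum-b-4k+3 M) ⟩
  (qP (P M) +P O M) +P (O M +P (qP (P M) +P qP (b M)))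
    ∎
  where
    open ≈P-Reasoning
    regroup-index : ∀ c →
      sumBelow (λ k → b (c + k * 2 * 2)) M ≈P sumBelow (λ k → b (c + k * 4)) M
    regroup-index c = sum-cong (λ k → ≡⇒≈P (cong (λ x → b (c + x)) (*-assoc k 2 2))) M

P-quadruple : ∀ M →
  P (M * 2 * 2) ≈P ((+ 3 ·P P (M * 2)) +P (+ 2 ·P (qP (P M) -P P M))) +P qP (b M)
P-quadruple M = begin
  P (M * 2 * 2)
    ≈⟨ P-double (M * 2) ⟩
  P (M * 2) +P O (M * 2)
    ≈⟨ +P-cong (P-double M) (O-double M) ⟩
  (P M +P O M) +P ((qP (P M) +P O M) +P (O M +P (qP (P M) +P qP (b M))))
    ≈⟨ (λ i → eliminate-O (P M i) (O M i) (qP (P M) i) (qP (b M) i)) ⟩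
  ((+ 3 ·P (P M +P O M)) +P (+ 2 ·P (qP (P M) -P P M))) +P qP (b M)
    ≈⟨ +P-congˡ (qP (b M)) (+P-congˡ (+ 2 ·P (qP (P M) -P P M))
                                       (·P-cong (+ 3) (P-double M))) ⟨
  ((+ 3 ·P P (M * 2)) +P (+ 2 ·P (qP (P M) -P P M))) +P qP (b M)
    ∎
  where
    open ≈P-Reasoning
    eliminate-O : ∀ p o qp qb →
      (p ℤ.+ o) ℤ.+ ((qp ℤ.+ o) ℤ.+ (o ℤ.+ (qp ℤ.+ qb)))
        ≡ ((+ 3 ℤ.* (p ℤ.+ o)) ℤ.+ (+ 2 ℤ.* (qp ℤ.- p))) ℤ.+ qb
    eliminate-O = ℤ-Ring.solve-∀

sumB-as-P : ∀ K → sumB K ≈P P (suc K)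
sumB-as-P zero    i = refl
sumB-as-P (suc K) i = cong (ℤ._+ b (suc K) i) (sumB-as-P K i)

b-pow : ∀ n → b (2 ^ n) ≡ 1P
b-pow zero    = refl
b-pow (suc n) = trans (cong b (*-comm 2 (2 ^ n))) (trans (b-double (2 ^ n)) (b-pow n))

L-as-P : ∀ n → L n ≈P (+ 2 ·P P (2 ^ n)) +P 1P
L-as-P n = +P-cong (·P-cong (+ 2) sum≈P) (≡⇒≈P (b-pow n))
  where
    sum≈P : sumB (2 ^ n ∸ 1) ≈P P (2 ^ n)
    sum≈P i = trans (sumB-as-P (2 ^ n ∸ 1) i) (cong (λ N → P N i) (m+[n∸m]≡n (m^n>0 2 n)))

-- With M = 2^m the
-- three values of L are 2 P(4M) + 1, 2 P(2M) + 1 and 2 P M + 1, and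
-- P-quadruple with b_M = 1 relates the three partial sums.
L-recurrence : ∀ m → L (2 + m) ≈P (+ 3 ·P L (1 + m)) +P (+ 2 ·P (qP (L m) -P L m))
L-recurrence m = begin
  L (2 + m)
    ≈⟨ L-2+m ⟩
  (+ 2 ·P P (M * 2 * 2)) +P 1P
    ≈⟨ +P-congˡ 1P (·P-cong (+ 2) P-4M) ⟩
  (+ 2 ·P (((+ 3 ·P P (M * 2)) +P (+ 2 ·P (qP (P M) -P P M))) +P qP 1P)) +P 1P
    ≈⟨ (λ i → regroup (P (M * 2) i) (P M i) (qP (P M) i) (qP 1P i) (1P i)) ⟩
  (+ 3 ·P ((+ 2 ·P P (M * 2)) +P 1P))
    +P (+ 2 ·P (((+ 2 ·P qP (P M)) +P qP 1P) -P ((+ 2 ·P P M) +P 1P)))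
    ≈⟨ +P-cong (·P-cong (+ 3) L-1+m) (·P-cong (+ 2) (-P-cong qP-L-m (L-as-P m))) ⟨
  (+ 3 ·P L (1 + m)) +P (+ 2 ·P (qP (L m) -P L m))
    ∎
  where
    open ≈P-Reasoning
    M = 2 ^ m

    L-2+m : L (2 + m) ≈P (+ 2 ·P P (M * 2 * 2)) +P 1P
    L-2+m i = trans (L-as-P (2 + m) i)
      (cong (λ N → ((+ 2 ·P P N) +P 1P) i) (trans (*-comm 2 (2 ^ suc m)) (cong (_* 2) (*-comm 2 M))))

    L-1+m : L (1 + m) ≈P (+ 2 ·P P (M * 2)) +P 1P
    L-1+m i = trans (L-as-P (1 + m) i) (cong (λ N → ((+ 2 ·P P N) +P 1P) i) (*-comm 2 M))

    qP-L-m : qP (L m) ≈P (+ 2 ·P qP (P M)) +P qP 1P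
    qP-L-m = begin
      qP (L m)                    ≈⟨ qP-cong (L-as-P m) ⟩
      qP ((+ 2 ·P P M) +P 1P)     ≈⟨ qP-+ (+ 2 ·P P M) 1P ⟩
      qP (+ 2 ·P P M) +P qP 1P    ≈⟨ +P-congˡ (qP 1P) (qP-· (+ 2) (P M)) ⟩
      (+ 2 ·P qP (P M)) +P qP 1P  ∎

    P-4M : P (M * 2 * 2) ≈P ((+ 3 ·P P (M * 2)) +P (+ 2 ·P (qP (P M) -P P M))) +P qP 1P
    P-4M i = trans (P-quadruple M i)
      (cong (λ u → (((+ 3 ·P P (M * 2)) +P (+ 2 ·P (qP (P M) -P P M))) +P qP u) i) (b-pow m))

    regroup : ∀ x p qp q1 u →
      + 2 ℤ.* (((+ 3 ℤ.* x) ℤ.+ (+ 2 ℤ.* (qp ℤ.- p))) ℤ.+ q1) ℤ.+ u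
        ≡ (+ 3 ℤ.* ((+ 2 ℤ.* x) ℤ.+ u))
          ℤ.+ (+ 2 ℤ.* (((+ 2 ℤ.* qp) ℤ.+ q1) ℤ.- ((+ 2 ℤ.* p) ℤ.+ u)))
    regroup = ℤ-Ring.solve-∀

theorem2p1 : ∀ (n : ℕ) → n ≥ 2 →
    L (suc n) ≈P ((+ 3 ·P L n) +P (+ 2 ·P (qP (L (n ∸ 1)) -P L (n ∸ 1))))
theorem2p1 (suc zero) (s≤s ())
theorem2p1 (suc (suc k)) _ = L-recurrence (suc k)
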